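{- Let $v\ge 2$ and let $C$ be a uniform covering array $\mathrm{UCA}(v^2+v-1;v+2,v)$. For $0\le i\le v+2$ let $a_i$ be the number of rows of $C$ that contain exactly $i$ high frequency entries. Then \begin{align*} \sum_{i=0}^{v+2} a_i &= v^2+v-1,\\ \sum_{i=0}^{v+2} i\,a_i &= (v+2)(v-1)(v+1),\\ \sum_{i=0}^{v+2} i^2 a_i &= (v+2)(v+1)^2(v-1). \end{align*} Further, $a_0\le 1$ and $a_1=a_2=0$.
   Context: A (strength-$2$) covering array $\mathrm{CA}(N;k,v)$ is an $N\times k$ array with entries from $\{0,1,\dots,v-1\}$ such that for every choice of two distinct columns $c,c'$ and every pair $(x,y)$ of symbols, there is at least one row with entry $x$ in column $c$ and entry $y$ in column $c'$. It is uniform, written $\mathrm{UCA}(N;k,v)$, if in every column every symbol occurs either $\lfloor N/v\rfloor$ or $\lceil N/v\rceil$ times. An entry of a $\mathrm{UCA}(N;k,v)$ is a high frequency entry if the symbol in that entry occurs at least $v+1$ times in the entry's column. -}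

module Defs where

open import Data.Nat using (ℕ; _+_; _*_; _∸_; _≤_; _≤?_; NonZero; suc)
open import Data.Nat.DivMod using (_/_)
open import Data.Fin using (Fin; _≟_)
open import Data.List using (List; length; filter; map; upTo; allFin)
open import Data.Nat.ListAction using (sum)
open import Data.Product using (∃; _×_)
open import Data.Sum using (_⊎_)
open import Relation.Binary.PropositionalEquality using (_≡_; _≢_)
import Data.Nat as ℕ
open import Relation.Nullary using (Dec)

Array : ℕ → ℕ → ℕ → Set
Array N k v = Fin N → Fin k → Fin v

occ : ∀ {N k v} → Array N k v → Fin k → Fin v → ℕ
occ {N} C c x = length (filter (λ r → C r c ≟ x) (allFin N))

IsCoveringArray : ∀ {N k v} → Array N k v → Set
IsCoveringArray {N} {k} {v} C =
  (c c' : Fin k) → c ≢ c' → (x y : Fin v) →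
  ∃ λ (r : Fin N) → (C r c ≡ x) × (C r c' ≡ y)

⌈_/_⌉ : ℕ → (v : ℕ) → .{{NonZero v}} → ℕ
⌈ N / v ⌉ = (N + (v ∸ 1)) / v

IsUniform : ∀ {N k v} .{{_ : NonZero v}} → Array N k v → Set
IsUniform {N} {k} {v} C =
  (c : Fin k) (x : Fin v) → (occ C c x ≡ N / v) ⊎ (occ C c x ≡ ⌈ N / v ⌉)

IsUCA : ∀ {N k v} .{{_ : NonZero v}} → Array N k v → Set
IsUCA C = IsCoveringArray C × IsUniform C

HighFreq : ∀ {N k v} → Array N k v → Fin N → Fin k → Set
HighFreq {v = v} C r c = suc v ≤ occ C c (C r c)

highFreq? : ∀ {N k v} (C : Array N k v) (r : Fin N) (c : Fin k) →
            Dec (HighFreq C r c)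
highFreq? {v = v} C r c = suc v ≤? occ C c (C r c)

hfCount : ∀ {N k v} → Array N k v → Fin N → ℕ
hfCount {k = k} C r = length (filter (highFreq? C r) (allFin k))

a : ∀ {N k v} → Array N k v → ℕ → ℕ
a {N} C i = length (filter (λ r → hfCount C r ℕ.≟ i) (allFin N))

sumTo : ℕ → (ℕ → ℕ) → ℕ
sumTo m f = sum (map f (upTo (suc m)))

-- Uniformity forces each column to contain v − 1 symbols occurring v + 1 times and one low
-- symbol occurring v times. Paired with another column, the v pairs through a low symbol are
-- all covered and their counts sum to v, so each is covered exactly once. The three moments
-- of (aᵢ) then follow by double counting rows, entries and pairs of high entries (two columns
-- are simultaneously high in N − 2v + 1 rows). For a row r with s low entries, another row
-- agrees with r in at most one of its low columns, so at least s(v − 1) other rows share a low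
-- entry with r, whereas rows sharing a high entry with r share no low entry with it. With one
-- or two high entries these families together exceed the N = v² + v − 1 rows. A row without
-- high entries is low in two fixed columns, which only one row is, so a₀ ≤ 1.

module Submission where

open import Defs
open import Data.Empty using (⊥-elim)
open import Data.Fin using (Fin; zero; suc; _≟_; toℕ; fromℕ<; punchIn)
open import Data.Fin.Properties using (toℕ-fromℕ<; toℕ-injective; punchInᵢ≢i)
open import Data.List using (map; upTo; applyUpTo; tabulate; filter; length)
open import Data.List.Properties using (map-cong)
open import Data.Nat using (ℕ; zero; suc; _+_; _*_; _∸_; _≤_; _<_; _≤?_; z≤n; s≤s; NonZero; >-nonZero⁻¹)
import Data.Nat as ℕ
import Data.Nat.ListAction as List
open import Data.Nat.DivMod using (_/_; +-distrib-/-∣ˡ; m*n/n≡m; m<n⇒m/n≡0)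
open import Data.Nat.Divisibility using (n∣m*n)
open import Data.Nat.Properties hiding (_≟_)
open import Algebra.Properties.Semiring.Sum +-*-semiring
  using (sum-syntax; sum-cong-≗; ∑-distrib-+; ∑-comm; sum-remove; *-distribˡ-sum; *-distribʳ-sum)
open import Data.Nat.Tactic.RingSolver using (solve-∀)
open import Data.Product using (∃; ∃₂; _×_; _,_; proj₁; proj₂)
open import Data.Sum using (_⊎_; inj₁; inj₂; [_,_]) renaming (map to ⊎-map)
open import Function using (_∘_)
open import Level using (Level)
open import Relation.Nullary using (Dec; yes; no; ¬_; ¬?; contradiction)
open import Relation.Nullary.Decidable using (_×-dec_; _⊎-dec_)
open import Relation.Unary using (Pred; Decidable)
open import Relation.Binary.PropositionalEquality
  using (_≡_; _≢_; refl; sym; trans; cong; cong₂; subst; subst₂; module ≡-Reasoning)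

private variable
  ℓ ℓ′ : Level
  A B : Set ℓ
  n : ℕ

-- Indicators and sums over Fin n

𝟙 : Dec A → ℕ
𝟙 (yes _) = 1
𝟙 (no _)  = 0

𝟙-yes : A → (a? : Dec A) → 𝟙 a? ≡ 1
𝟙-yes a (yes _) = refl
𝟙-yes a (no ¬a) = ⊥-elim (¬a a)

𝟙-no : ¬ A → (a? : Dec A) → 𝟙 a? ≡ 0
𝟙-no ¬a (yes a) = ⊥-elim (¬a a)
𝟙-no ¬a (no _)  = refl

𝟙≤1 : (a? : Dec A) → 𝟙 a? ≤ 1
𝟙≤1 (yes _) = s≤s z≤n
𝟙≤1 (no _)  = z≤n

𝟙-cong : (A → B) → (B → A) → (a? : Dec A) (b? : Dec B) → 𝟙 a? ≡ 𝟙 b?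
𝟙-cong f g (yes a) b? = sym (𝟙-yes (f a) b?)
𝟙-cong f g (no ¬a) b? = sym (𝟙-no (¬a ∘ g) b?)

𝟙-mono : (A → B) → (a? : Dec A) (b? : Dec B) → 𝟙 a? ≤ 𝟙 b?
𝟙-mono f (yes a) b? = ≤-reflexive (sym (𝟙-yes (f a) b?))
𝟙-mono f (no _)  b? = z≤n

𝟙-¬ : (a? : Dec A) → 𝟙 a? + 𝟙 (¬? a?) ≡ 1
𝟙-¬ (yes _) = refl
𝟙-¬ (no _)  = refl

𝟙-× : (a? : Dec A) (b? : Dec B) → 𝟙 (a? ×-dec b?) ≡ 𝟙 a? * 𝟙 b?
𝟙-× (yes _) (yes _) = refl
𝟙-× (yes _) (no _)  = refl
𝟙-× (no _)  (yes _) = refl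
𝟙-× (no _)  (no _)  = refl

𝟙-⊎ : (a? : Dec A) (b? : Dec B) → 𝟙 a? + 𝟙 b? ≡ 𝟙 (a? ×-dec b?) + 𝟙 (a? ⊎-dec b?)
𝟙-⊎ (yes _) (yes _) = refl
𝟙-⊎ (yes _) (no _)  = refl
𝟙-⊎ (no _)  (yes _) = refl
𝟙-⊎ (no _)  (no _)  = refl

𝟙-×-¬ : (a? : Dec A) (b? : Dec B) →
        𝟙 (a? ×-dec b?) + (𝟙 (¬? a?) + 𝟙 (¬? b?)) ≡ 1 + 𝟙 (¬? a? ×-dec ¬? b?)
𝟙-×-¬ (yes _) (yes _) = refl
𝟙-×-¬ (yes _) (no _)  = refl
𝟙-×-¬ (no _)  (yes _) = refl
𝟙-×-¬ (no _)  (no _)  = refl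

∑-const : ∀ n x → ∑[ i < n ] x ≡ n * x
∑-const zero    x = refl
∑-const (suc n) x = cong (x +_) (∑-const n x)

∑-one : ∀ n → ∑[ i < n ] 1 ≡ n
∑-one n = trans (∑-const n 1) (*-identityʳ n)

∑-mono-≤ : ∀ {f g : Fin n → ℕ} → (∀ i → f i ≤ g i) → ∑[ i < n ] f i ≤ ∑[ i < n ] g i
∑-mono-≤ {zero}  f≤g = z≤n
∑-mono-≤ {suc n} f≤g = +-mono-≤ (f≤g zero) (∑-mono-≤ (f≤g ∘ suc))

∑-select : ∀ (j : Fin n) (f : Fin n → ℕ) → ∑[ i < n ] (𝟙 (j ≟ i) * f i) ≡ f j
∑-select {suc n} j f = begin
  ∑[ i < suc n ] (𝟙 (j ≟ i) * f i)                         ≡⟨ sum-remove {i = j} (λ i → 𝟙 (j ≟ i) * f i) ⟩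
  𝟙 (j ≟ j) * f j + ∑[ i < n ] (𝟙 (j ≟ punchIn j i) * f (punchIn j i))
    ≡⟨ cong₂ _+_ (cong (_* f j) (𝟙-yes refl (j ≟ j))) (sum-cong-≗ off-diagonal) ⟩
  1 * f j + ∑[ i < n ] 0                                    ≡⟨ cong₂ _+_ (*-identityˡ (f j)) (∑-const n 0) ⟩
  f j + n * 0                                               ≡⟨ cong (f j +_) (*-zeroʳ n) ⟩
  f j + 0                                                   ≡⟨ +-identityʳ (f j) ⟩
  f j                                                       ∎
  where
  open ≡-Reasoning
  off-diagonal : ∀ i → 𝟙 (j ≟ punchIn j i) * f (punchIn j i) ≡ 0
  off-diagonal i = cong (_* f (punchIn j i)) (𝟙-no (punchInᵢ≢i j i ∘ sym) (j ≟ punchIn j i))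

-- Counting the elements of Fin n satisfying a decidable predicate

count : {P : Pred (Fin n) ℓ} → Decidable P → ℕ
count {n} P? = ∑[ i < n ] 𝟙 (P? i)

count-≡ : ∀ (j : Fin n) → count (j ≟_) ≡ 1
count-≡ j = trans (sum-cong-≗ (λ i → sym (*-identityʳ (𝟙 (j ≟ i))))) (∑-select j (λ _ → 1))

1≤f⇒f[j]+n≤∑f+1 : ∀ {f : Fin n → ℕ} (j : Fin n) → (∀ i → 1 ≤ f i) → f j + n ≤ ∑[ i < n ] f i + 1
1≤f⇒f[j]+n≤∑f+1 {n} {f} j 1≤f = begin
  f j + n                                      ≡⟨ +-comm (f j) n ⟩
  n + f j                                      ≡⟨ cong₂ _+_ (sym (∑-one n)) (sym (∑-select j f)) ⟩
  ∑[ i < n ] 1 + ∑[ i < n ] (𝟙 (j ≟ i) * f i) ≡⟨ sym (∑-distrib-+ (λ _ → 1) (λ i → 𝟙 (j ≟ i) * f i)) ⟩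
  ∑[ i < n ] (1 + 𝟙 (j ≟ i) * f i)            ≤⟨ ∑-mono-≤ pointwise ⟩
  ∑[ i < n ] (f i + 𝟙 (j ≟ i))                 ≡⟨ ∑-distrib-+ f (λ i → 𝟙 (j ≟ i)) ⟩
  ∑[ i < n ] f i + ∑[ i < n ] 𝟙 (j ≟ i)        ≡⟨ cong (∑[ i < n ] f i +_) (count-≡ j) ⟩
  ∑[ i < n ] f i + 1                           ∎
  where
  open ≤-Reasoning
  pointwise : ∀ i → 1 + 𝟙 (j ≟ i) * f i ≤ f i + 𝟙 (j ≟ i)
  pointwise i with j ≟ i
  ... | yes refl = ≤-reflexive (trans (cong suc (+-identityʳ (f j))) (+-comm 1 (f j)))
  ... | no _     = ≤-trans (1≤f i) (m≤m+n (f i) 0)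

∑-except : ∀ {f : Fin n → ℕ} (j : Fin n) {x} → (∀ i → j ≢ i → f i ≡ x) →
           ∑[ i < n ] f i + x ≡ f j + n * x
∑-except {n} {f} j {x} f≡x = begin
  ∑[ i < n ] f i + x                           ≡⟨ cong (∑[ i < n ] f i +_) (sym (∑-select j (λ _ → x))) ⟩
  ∑[ i < n ] f i + ∑[ i < n ] (𝟙 (j ≟ i) * x) ≡⟨ ∑-distrib-+ f (λ i → 𝟙 (j ≟ i) * x) ⟨
  ∑[ i < n ] (f i + 𝟙 (j ≟ i) * x)            ≡⟨ sum-cong-≗ pointwise ⟩
  ∑[ i < n ] (x + 𝟙 (j ≟ i) * f i)            ≡⟨ ∑-distrib-+ (λ _ → x) (λ i → 𝟙 (j ≟ i) * f i) ⟩
  ∑[ i < n ] x + ∑[ i < n ] (𝟙 (j ≟ i) * f i) ≡⟨ cong₂ _+_ (∑-const n x) (∑-select j f) ⟩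
  n * x + f j                                  ≡⟨ +-comm (n * x) (f j) ⟩
  f j + n * x                                  ∎
  where
  open ≡-Reasoning
  pointwise : ∀ i → f i + 𝟙 (j ≟ i) * x ≡ x + 𝟙 (j ≟ i) * f i
  pointwise i with j ≟ i
  ... | yes refl = begin
    f j + 1 * x ≡⟨ cong (f j +_) (*-identityˡ x) ⟩
    f j + x     ≡⟨ +-comm (f j) x ⟩
    x + f j     ≡⟨ cong (x +_) (*-identityˡ (f j)) ⟨
    x + 1 * f j ∎
  ... | no j≢i   = trans (+-identityʳ (f i)) (trans (f≡x i j≢i) (sym (+-identityʳ x)))

∑≤support : ∀ {f : Fin n → ℕ} (j : Fin n) → 1 ≤ f j → (∀ i → j ≢ i → f i ≤ 1) →
            ∑[ i < n ] f i + 1 ≤ count (λ i → 1 ≤? f i) + f j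
∑≤support {n} {f} j 1≤fj f≤1 = begin
  ∑[ i < n ] f i + 1                             ≡⟨ cong (∑[ i < n ] f i +_) (count-≡ j) ⟨
  ∑[ i < n ] f i + ∑[ i < n ] 𝟙 (j ≟ i)          ≡⟨ ∑-distrib-+ f (𝟙 ∘ (j ≟_)) ⟨
  ∑[ i < n ] (f i + 𝟙 (j ≟ i))                   ≤⟨ ∑-mono-≤ pointwise ⟩
  ∑[ i < n ] (𝟙 (1 ≤? f i) + 𝟙 (j ≟ i) * f i)    ≡⟨ ∑-distrib-+ (λ i → 𝟙 (1 ≤? f i)) (λ i → 𝟙 (j ≟ i) * f i) ⟩
  count (λ i → 1 ≤? f i) + ∑[ i < n ] (𝟙 (j ≟ i) * f i) ≡⟨ cong (count (λ i → 1 ≤? f i) +_) (∑-select j f) ⟩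
  count (λ i → 1 ≤? f i) + f j                   ∎
  where
  open ≤-Reasoning
  pointwise : ∀ i → f i + 𝟙 (j ≟ i) ≤ 𝟙 (1 ≤? f i) + 𝟙 (j ≟ i) * f i
  pointwise i with j ≟ i
  ... | yes refl = ≤-reflexive (begin-equality
    f j + 1                     ≡⟨ +-comm (f j) 1 ⟩
    1 + f j                     ≡⟨ cong₂ _+_ (𝟙-yes 1≤fj (1 ≤? f j)) (*-identityˡ (f j)) ⟨
    𝟙 (1 ≤? f j) + 1 * f j      ∎)
  ... | no j≢i with f i | f≤1 i j≢i
  ...   | zero  | _       = z≤n
  ...   | suc _ | s≤s z≤n = s≤s z≤n

count-cong : {P : Pred (Fin n) ℓ} {Q : Pred (Fin n) ℓ′} (P? : Decidable P) (Q? : Decidable Q) →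
             (∀ i → P i → Q i) → (∀ i → Q i → P i) → count P? ≡ count Q?
count-cong P? Q? P⇒Q Q⇒P = sum-cong-≗ (λ i → 𝟙-cong (P⇒Q i) (Q⇒P i) (P? i) (Q? i))

count-mono : {P : Pred (Fin n) ℓ} {Q : Pred (Fin n) ℓ′} (P? : Decidable P) (Q? : Decidable Q) →
             (∀ i → P i → Q i) → count P? ≤ count Q?
count-mono P? Q? P⇒Q = ∑-mono-≤ (λ i → 𝟙-mono (P⇒Q i) (P? i) (Q? i))

count≤n : {P : Pred (Fin n) ℓ} (P? : Decidable P) → count P? ≤ n
count≤n {n = n} P? = ≤-trans (∑-mono-≤ (𝟙≤1 ∘ P?)) (≤-reflexive (∑-one n))

count-none : {P : Pred (Fin n) ℓ} (P? : Decidable P) → (∀ i → ¬ P i) → count P? ≡ 0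
count-none {n = n} P? ¬P = trans (sum-cong-≗ (λ i → 𝟙-no (¬P i) (P? i))) (trans (∑-const n 0) (*-zeroʳ n))

count-pos : {P : Pred (Fin n) ℓ} (P? : Decidable P) {i : Fin n} → P i → 1 ≤ count P?
count-pos P? {i} Pi = ≤-trans (≤-reflexive (sym (count-≡ i))) (count-mono (i ≟_) P? (λ _ i≡j → subst _ i≡j Pi))

count-complement : {P : Pred (Fin n) ℓ} (P? : Decidable P) → count P? + count (¬? ∘ P?) ≡ n
count-complement {n = n} P? = begin
  count P? + count (¬? ∘ P?)            ≡⟨ ∑-distrib-+ (𝟙 ∘ P?) (𝟙 ∘ ¬? ∘ P?) ⟨
  ∑[ i < n ] (𝟙 (P? i) + 𝟙 (¬? (P? i))) ≡⟨ sum-cong-≗ (𝟙-¬ ∘ P?) ⟩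
  ∑[ i < n ] 1                          ≡⟨ ∑-one n ⟩
  n                                     ∎
  where open ≡-Reasoning

count-∪ : {P : Pred (Fin n) ℓ} {Q : Pred (Fin n) ℓ′} (P? : Decidable P) (Q? : Decidable Q) →
          count P? + count Q? ≡ count (λ i → P? i ×-dec Q? i) + count (λ i → P? i ⊎-dec Q? i)
count-∪ {n = n} P? Q? = begin
  count P? + count Q?                       ≡⟨ ∑-distrib-+ (𝟙 ∘ P?) (𝟙 ∘ Q?) ⟨
  ∑[ i < n ] (𝟙 (P? i) + 𝟙 (Q? i))          ≡⟨ sum-cong-≗ (λ i → 𝟙-⊎ (P? i) (Q? i)) ⟩
  ∑[ i < n ] (𝟙 (P? i ×-dec Q? i) + 𝟙 (P? i ⊎-dec Q? i))
    ≡⟨ ∑-distrib-+ (λ i → 𝟙 (P? i ×-dec Q? i)) (λ i → 𝟙 (P? i ⊎-dec Q? i)) ⟩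
  count (λ i → P? i ×-dec Q? i) + count (λ i → P? i ⊎-dec Q? i) ∎
  where open ≡-Reasoning

count-⊎≤ : {P : Pred (Fin n) ℓ} {Q : Pred (Fin n) ℓ′} (P? : Decidable P) (Q? : Decidable Q) →
           count (λ i → P? i ⊎-dec Q? i) ≤ count P? + count Q?
count-⊎≤ P? Q? = ≤-trans (m≤n+m _ _) (≤-reflexive (sym (count-∪ P? Q?)))

count-inclusion-exclusion :
  {P : Pred (Fin n) ℓ} {Q : Pred (Fin n) ℓ′} (P? : Decidable P) (Q? : Decidable Q) →
  count (λ i → P? i ×-dec Q? i) + (count (¬? ∘ P?) + count (¬? ∘ Q?))
    ≡ n + count (λ i → ¬? (P? i) ×-dec ¬? (Q? i))
count-inclusion-exclusion {n = n} P? Q? = begin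
  count (λ i → P? i ×-dec Q? i) + (count (¬? ∘ P?) + count (¬? ∘ Q?))
    ≡⟨ cong (count (λ i → P? i ×-dec Q? i) +_) (∑-distrib-+ (𝟙 ∘ ¬? ∘ P?) (𝟙 ∘ ¬? ∘ Q?)) ⟨
  count (λ i → P? i ×-dec Q? i) + ∑[ i < n ] (𝟙 (¬? (P? i)) + 𝟙 (¬? (Q? i)))
    ≡⟨ ∑-distrib-+ (λ i → 𝟙 (P? i ×-dec Q? i)) _ ⟨
  ∑[ i < n ] (𝟙 (P? i ×-dec Q? i) + (𝟙 (¬? (P? i)) + 𝟙 (¬? (Q? i))))
    ≡⟨ sum-cong-≗ (λ i → 𝟙-×-¬ (P? i) (Q? i)) ⟩
  ∑[ i < n ] (1 + 𝟙 (¬? (P? i) ×-dec ¬? (Q? i)))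
    ≡⟨ ∑-distrib-+ (λ _ → 1) (λ i → 𝟙 (¬? (P? i) ×-dec ¬? (Q? i))) ⟩
  ∑[ i < n ] 1 + count (λ i → ¬? (P? i) ×-dec ¬? (Q? i))
    ≡⟨ cong (_+ count (λ i → ¬? (P? i) ×-dec ¬? (Q? i))) (∑-one n) ⟩
  n + count (λ i → ¬? (P? i) ×-dec ¬? (Q? i)) ∎
  where open ≡-Reasoning

count-witness : {P : Pred (Fin n) ℓ} (P? : Decidable P) → 1 ≤ count P? → ∃ P
count-witness {n = suc n} P? 1≤count with P? zero
... | yes Pi = zero , Pi
... | no _   = let (i , Pi) = count-witness (P? ∘ suc) 1≤count in suc i , Pi

count-pair : {P : Pred (Fin n) ℓ} (P? : Decidable P) {i j : Fin n} →
             i ≢ j → P i → P j → 2 ≤ count P?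
count-pair {n = n} P? {i} {j} i≢j Pi Pj = begin
  2                                            ≡⟨ cong₂ _+_ (count-≡ i) (count-≡ j) ⟨
  ∑[ x < n ] 𝟙 (i ≟ x) + ∑[ x < n ] 𝟙 (j ≟ x) ≡⟨ ∑-distrib-+ (𝟙 ∘ (i ≟_)) (𝟙 ∘ (j ≟_)) ⟨
  ∑[ x < n ] (𝟙 (i ≟ x) + 𝟙 (j ≟ x))          ≤⟨ ∑-mono-≤ pointwise ⟩
  count P?                                     ∎
  where
  open ≤-Reasoning
  pointwise : ∀ x → 𝟙 (i ≟ x) + 𝟙 (j ≟ x) ≤ 𝟙 (P? x)
  pointwise x with i ≟ x | j ≟ x
  ... | yes refl | yes refl = ⊥-elim (i≢j refl)
  ... | yes refl | no _     = ≤-reflexive (sym (𝟙-yes Pi (P? x)))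
  ... | no _     | yes refl = ≤-reflexive (sym (𝟙-yes Pj (P? x)))
  ... | no _     | no _     = z≤n

count-another-witness : {P : Pred (Fin n) ℓ} (P? : Decidable P) {i : Fin n} →
                        2 ≤ count P? → ∃ λ j → i ≢ j × P j
count-another-witness {n = n} {P = P} P? {i} 2≤count =
  count-witness others? (+-cancelˡ-≤ 1 1 _ (≤-trans 2≤count split))
  where
  others? : Decidable (λ j → i ≢ j × P j)
  others? j = ¬? (i ≟ j) ×-dec P? j
  pointwise : ∀ x → 𝟙 (P? x) ≤ 𝟙 (i ≟ x) + 𝟙 (others? x)
  pointwise x with i ≟ x | P? x
  ... | yes _  | Px?    = ≤-trans (𝟙≤1 Px?) (m≤m+n 1 _)
  ... | no _   | yes _  = ≤-refl
  ... | no _   | no _   = z≤n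
  split : count P? ≤ 1 + count others?
  split = begin
    count P?                                ≤⟨ ∑-mono-≤ pointwise ⟩
    ∑[ x < n ] (𝟙 (i ≟ x) + 𝟙 (others? x)) ≡⟨ ∑-distrib-+ (𝟙 ∘ (i ≟_)) (𝟙 ∘ others?) ⟩
    ∑[ x < n ] 𝟙 (i ≟ x) + count others?   ≡⟨ cong (_+ count others?) (count-≡ i) ⟩
    1 + count others?                       ∎
    where open ≤-Reasoning

count-two-witnesses : {P : Pred (Fin n) ℓ} (P? : Decidable P) →
                      2 ≤ count P? → ∃₂ λ i j → i ≢ j × P i × P j
count-two-witnesses P? 2≤count
  with i , Pi ← count-witness P? (≤-trans (s≤s z≤n) 2≤count)
  with j , i≢j , Pj ← count-another-witness P? {i} 2≤count
  = i , j , i≢j , Pi , Pj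

count≤1 : {P : Pred (Fin n) ℓ} (P? : Decidable P) → (∀ i j → P i → P j → i ≡ j) → count P? ≤ 1
count≤1 P? unique with count P? ≤? 1
... | yes ≤1 = ≤1
... | no ≰1 with i , j , i≢j , Pi , Pj ← count-two-witnesses P? (≰⇒> ≰1) = ⊥-elim (i≢j (unique i j Pi Pj))

∑-fibres : ∀ {m} (h : Fin n → ℕ) → (∀ i → h i < m) → (g : ℕ → ℕ) →
           ∑[ k < m ] (g (toℕ k) * count (λ i → h i ℕ.≟ toℕ k)) ≡ ∑[ i < n ] g (h i)
∑-fibres {n} {m} h h<m g = begin
  ∑[ k < m ] (g (toℕ k) * count (λ i → h i ℕ.≟ toℕ k))
    ≡⟨ sum-cong-≗ {m} (λ k → *-distribˡ-sum (g (toℕ k)) (λ i → 𝟙 (h i ℕ.≟ toℕ k))) ⟩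
  ∑[ k < m ] ∑[ i < n ] (g (toℕ k) * 𝟙 (h i ℕ.≟ toℕ k))
    ≡⟨ ∑-comm {m} {n} (λ k i → g (toℕ k) * 𝟙 (h i ℕ.≟ toℕ k)) ⟩
  ∑[ i < n ] ∑[ k < m ] (g (toℕ k) * 𝟙 (h i ℕ.≟ toℕ k))
    ≡⟨ sum-cong-≗ (λ i → sum-cong-≗ (λ k → trans (*-comm (g (toℕ k)) _) (cong (_* g (toℕ k)) (fibre i k)))) ⟩
  ∑[ i < n ] ∑[ k < m ] (𝟙 (fromℕ< (h<m i) ≟ k) * g (toℕ k))
    ≡⟨ sum-cong-≗ (λ i → trans (∑-select (fromℕ< (h<m i)) (g ∘ toℕ)) (cong g (toℕ-fromℕ< (h<m i)))) ⟩
  ∑[ i < n ] g (h i) ∎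
  where
  open ≡-Reasoning
  fibre : ∀ i k → 𝟙 (h i ℕ.≟ toℕ k) ≡ 𝟙 (fromℕ< (h<m i) ≟ k)
  fibre i k = 𝟙-cong (λ hi≡k → toℕ-injective (trans (toℕ-fromℕ< (h<m i)) hi≡k))
                     (λ i≡k → trans (sym (toℕ-fromℕ< (h<m i))) (cong toℕ i≡k))
                     (h i ℕ.≟ toℕ k) (fromℕ< (h<m i) ≟ k)

sum-applyUpTo : ∀ (f g : ℕ → ℕ) n → List.sum (map f (applyUpTo g n)) ≡ ∑[ i < n ] f (g (toℕ i))
sum-applyUpTo f g zero    = refl
sum-applyUpTo f g (suc n) = cong (f (g 0) +_) (sum-applyUpTo f (g ∘ suc) n)

length-filter-tabulate : {P : Pred A ℓ} (P? : Decidable P) (f : Fin n → A) →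
                         length (filter P? (tabulate f)) ≡ count (P? ∘ f)
length-filter-tabulate {n = zero}  P? f = refl
length-filter-tabulate {n = suc n} P? f with P? (f zero)
... | yes _ = cong suc (length-filter-tabulate P? (f ∘ suc))
... | no _  = length-filter-tabulate P? (f ∘ suc)

-- Occurrence numbers in a UCA(v² + v − 1; k, v)

[q*n+r]/n≡q : ∀ q {r} n .{{_ : NonZero n}} → r < n → (q * n + r) / n ≡ q
[q*n+r]/n≡q q {r} n r<n = begin
  (q * n + r) / n    ≡⟨ +-distrib-/-∣ˡ r (n∣m*n q) ⟩
  q * n / n + r / n  ≡⟨ cong₂ _+_ (m*n/n≡m q n) (m<n⇒m/n≡0 r<n) ⟩
  q + 0              ≡⟨ +-identityʳ q ⟩
  q                  ∎
  where open ≡-Reasoning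

uniform⇒occ≡v⊎1+v : ∀ {v k} (C : Array (v * v + v ∸ 1) k v) → 2 ≤ v → .{{_ : NonZero v}} →
                     IsUniform C → ∀ c x → occ C c x ≡ v ⊎ occ C c x ≡ suc v
uniform⇒occ≡v⊎1+v {suc (suc w)} C (s≤s (s≤s z≤n)) uniform c x =
  ⊎-map (λ occ≡⌊N/v⌋ → trans occ≡⌊N/v⌋ ⌊N/v⌋≡v) (λ occ≡⌈N/v⌉ → trans occ≡⌈N/v⌉ ⌈N/v⌉≡1+v) (uniform c x)
  where
  v : ℕ
  v = suc (suc w)
  N≡v*v+[v∸1] : v * v + v ∸ 1 ≡ v * v + suc w
  N≡v*v+[v∸1] = +-∸-assoc (v * v) (s≤s z≤n)
  v*v+2[v∸1]≡[v+1]*v+[v∸2] : ∀ w → let v = suc (suc w) in v * v + suc w + suc w ≡ suc v * v + w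
  v*v+2[v∸1]≡[v+1]*v+[v∸2] = solve-∀
  ⌊N/v⌋≡v : (v * v + v ∸ 1) / v ≡ v
  ⌊N/v⌋≡v = trans (cong (_/ v) N≡v*v+[v∸1]) ([q*n+r]/n≡q v v (n<1+n (suc w)))
  ⌈N/v⌉≡1+v : ⌈ v * v + v ∸ 1 / v ⌉ ≡ suc v
  ⌈N/v⌉≡1+v = begin
    (v * v + v ∸ 1 + suc w) / v  ≡⟨ cong (λ m → (m + suc w) / v) N≡v*v+[v∸1] ⟩
    (v * v + suc w + suc w) / v  ≡⟨ cong (_/ v) (v*v+2[v∸1]≡[v+1]*v+[v∸2] w) ⟩
    (suc v * v + w) / v          ≡⟨ [q*n+r]/n≡q (suc v) v (m≤n⇒m≤1+n (n<1+n w)) ⟩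
    suc v                        ∎
    where open ≡-Reasoning

-- With v = suc w the ring solver cannot see through ∸, so these identities are stated on
-- the form w + w * v + v to which v * v + v ∸ 1 reduces.
[v∸1]*[v+1]+v≡N : ∀ v → .{{NonZero v}} → (v ∸ 1) * (v + 1) + v ≡ v * v + v ∸ 1
[v∸1]*[v+1]+v≡N (suc w) = lemma w
  where
  lemma : ∀ w → let v = suc w in w * (v + 1) + v ≡ w + w * v + v
  lemma = solve-∀

[v∸1]*v+2v≡N+1 : ∀ v → .{{NonZero v}} → (v ∸ 1) * v + (v + v) ≡ (v * v + v ∸ 1) + 1
[v∸1]*v+2v≡N+1 (suc w) = lemma w
  where
  lemma : ∀ w → let v = suc w in w * v + (v + v) ≡ w + w * v + v + 1
  lemma = solve-∀

module UniformCoveringArray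
  {v : ℕ} .{{_ : NonZero v}}
  (C : Array (v * v + v ∸ 1) (v + 2) v)
  (covering : IsCoveringArray C)
  (occ≡v⊎1+v : ∀ c x → occ C c x ≡ v ⊎ occ C c x ≡ suc v)
  where

  N k : ℕ
  N = v * v + v ∸ 1
  k = v + 2

  N+1≡v*v+v : N + 1 ≡ v * v + v
  N+1≡v*v+v = m∸n+n≡m (≤-trans (>-nonZero⁻¹ v) (m≤n+m v (v * v)))

  occ≡count : ∀ c x → occ C c x ≡ count (λ r → C r c ≟ x)
  occ≡count c x = length-filter-tabulate (λ r → C r c ≟ x) (λ r → r)

  High : Fin k → Fin v → Set
  High c x = suc v ≤ occ C c x

  high? : ∀ c x → Dec (High c x)
  high? c x = suc v ≤? occ C c x

  occ-high : ∀ {c x} → High c x → occ C c x ≡ suc v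
  occ-high {c} {x} h with occ≡v⊎1+v c x
  ... | inj₁ occ≡v   = contradiction (subst (suc v ≤_) occ≡v h) (1+n≰n)
  ... | inj₂ occ≡1+v = occ≡1+v

  occ-low : ∀ {c x} → ¬ High c x → occ C c x ≡ v
  occ-low {c} {x} ¬h with occ≡v⊎1+v c x
  ... | inj₁ occ≡v   = occ≡v
  ... | inj₂ occ≡1+v = contradiction (≤-reflexive (sym occ≡1+v)) ¬h

  ∑-occ : ∀ c → ∑[ x < v ] occ C c x ≡ N
  ∑-occ c = begin
    ∑[ x < v ] occ C c x                    ≡⟨ sum-cong-≗ (occ≡count c) ⟩
    ∑[ x < v ] ∑[ r < N ] 𝟙 (C r c ≟ x)     ≡⟨ ∑-comm {v} {N} (λ x r → 𝟙 (C r c ≟ x)) ⟩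
    ∑[ r < N ] count (C r c ≟_)             ≡⟨ sum-cong-≗ (λ r → count-≡ (C r c)) ⟩
    ∑[ r < N ] 1                            ≡⟨ ∑-one N ⟩
    N                                       ∎
    where open ≡-Reasoning

  count-low-symbols : ∀ c → count (λ x → ¬? (high? c x)) ≡ 1
  count-low-symbols c = +-cancelˡ-≡ N _ 1 (begin
    N + count (λ x → ¬? (high? c x))
      ≡⟨ cong (_+ count (λ x → ¬? (high? c x))) (∑-occ c) ⟨
    ∑[ x < v ] occ C c x + ∑[ x < v ] 𝟙 (¬? (high? c x))
      ≡⟨ ∑-distrib-+ (occ C c) (λ x → 𝟙 (¬? (high? c x))) ⟨
    ∑[ x < v ] (occ C c x + 𝟙 (¬? (high? c x)))             ≡⟨ sum-cong-≗ occ+𝟙-low ⟩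
    ∑[ x < v ] suc v                                         ≡⟨ ∑-const v (suc v) ⟩
    v * suc v                                                ≡⟨ *-suc v v ⟩
    v + v * v                                                ≡⟨ +-comm v (v * v) ⟩
    v * v + v                                                ≡⟨ N+1≡v*v+v ⟨
    N + 1                                                    ∎)
    where
    open ≡-Reasoning
    occ+𝟙-low : ∀ x → occ C c x + 𝟙 (¬? (high? c x)) ≡ suc v
    occ+𝟙-low x with high? c x
    ... | yes h = trans (+-identityʳ _) (occ-high h)
    ... | no ¬h = trans (cong (_+ 1) (occ-low ¬h)) (+-comm v 1)

  low-symbol : ∀ c → ∃ λ x → ¬ High c x
  low-symbol c = count-witness (λ x → ¬? (high? c x)) (≤-reflexive (sym (count-low-symbols c)))

  lowSymbol : Fin k → Fin v
  lowSymbol c = proj₁ (low-symbol c)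

  lowSymbol-low : ∀ c → ¬ High c (lowSymbol c)
  lowSymbol-low c = proj₂ (low-symbol c)

  low⇒≡lowSymbol : ∀ {c x} → ¬ High c x → x ≡ lowSymbol c
  low⇒≡lowSymbol {c} {x} ¬h with x ≟ lowSymbol c
  ... | yes x≡ℓ = x≡ℓ
  ... | no x≢ℓ  = contradiction
    (subst (2 ≤_) (count-low-symbols c) (count-pair (λ y → ¬? (high? c y)) x≢ℓ ¬h (lowSymbol-low c)))
    (λ { (s≤s ()) })

  ≡lowSymbol⇒low : ∀ {c x} → x ≡ lowSymbol c → ¬ High c x
  ≡lowSymbol⇒low {c} x≡ℓ = subst (¬_ ∘ High c) (sym x≡ℓ) (lowSymbol-low c)

  Low : Fin N → Fin k → Set
  Low r c = ¬ HighFreq C r c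

  low? : ∀ r c → Dec (Low r c)
  low? r c = ¬? (highFreq? C r c)

  bothLow? : ∀ c c′ r → Dec (Low r c × Low r c′)
  bothLow? c c′ r = low? r c ×-dec low? r c′

  bothHigh? : ∀ c c′ r → Dec (HighFreq C r c × HighFreq C r c′)
  bothHigh? c c′ r = highFreq? C r c ×-dec highFreq? C r c′

  count-low-entries : ∀ c → count (λ r → low? r c) ≡ v
  count-low-entries c = begin
    count (λ r → low? r c)
      ≡⟨ count-cong (λ r → low? r c) (λ r → C r c ≟ lowSymbol c) (λ r → low⇒≡lowSymbol) (λ r → ≡lowSymbol⇒low) ⟩
    count (λ r → C r c ≟ lowSymbol c)   ≡⟨ occ≡count c (lowSymbol c) ⟨
    occ C c (lowSymbol c)               ≡⟨ occ-low (lowSymbol-low c) ⟩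
    v                                   ∎
    where open ≡-Reasoning

  count-high-entries : ∀ c → count (λ r → highFreq? C r c) + v ≡ N
  count-high-entries c =
    trans (cong (count (λ r → highFreq? C r c) +_) (sym (count-low-entries c)))
          (count-complement (λ r → highFreq? C r c))

  pairs : Fin k → Fin k → Fin v → Fin v → ℕ
  pairs c c′ x y = count (λ r → (C r c ≟ x) ×-dec (C r c′ ≟ y))

  ∑-pairs : ∀ c c′ x → ∑[ y < v ] pairs c c′ x y ≡ occ C c x
  ∑-pairs c c′ x = begin
    ∑[ y < v ] pairs c c′ x y
      ≡⟨ sum-cong-≗ (λ y → sum-cong-≗ (λ r → 𝟙-× (C r c ≟ x) (C r c′ ≟ y))) ⟩
    ∑[ y < v ] ∑[ r < N ] (𝟙 (C r c ≟ x) * 𝟙 (C r c′ ≟ y))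
      ≡⟨ ∑-comm {v} {N} (λ y r → 𝟙 (C r c ≟ x) * 𝟙 (C r c′ ≟ y)) ⟩
    ∑[ r < N ] ∑[ y < v ] (𝟙 (C r c ≟ x) * 𝟙 (C r c′ ≟ y))
      ≡⟨ sum-cong-≗ (λ r → *-distribˡ-sum (𝟙 (C r c ≟ x)) (λ y → 𝟙 (C r c′ ≟ y))) ⟨
    ∑[ r < N ] (𝟙 (C r c ≟ x) * count (C r c′ ≟_))
      ≡⟨ sum-cong-≗ (λ r → trans (cong (𝟙 (C r c ≟ x) *_) (count-≡ (C r c′))) (*-identityʳ _)) ⟩
    count (λ r → C r c ≟ x)
      ≡⟨ occ≡count c x ⟨
    occ C c x ∎
    where open ≡-Reasoning

  pairs-covered : ∀ {c c′} → c ≢ c′ → ∀ x y → 1 ≤ pairs c c′ x y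
  pairs-covered c≢c′ x y = let (r , Crc≡x , Crc′≡y) = covering _ _ c≢c′ x y in
    count-pos (λ r → (C r _ ≟ x) ×-dec (C r _ ≟ y)) (Crc≡x , Crc′≡y)

  pairs+v≤occ+1 : ∀ {c c′} → c ≢ c′ → ∀ x y → pairs c c′ x y + v ≤ occ C c x + 1
  pairs+v≤occ+1 c≢c′ x y =
    subst (λ t → pairs _ _ x y + v ≤ t + 1) (∑-pairs _ _ x) (1≤f⇒f[j]+n≤∑f+1 y (pairs-covered c≢c′ x))

  pairs-low : ∀ {c c′} → c ≢ c′ → ∀ {x} y → ¬ High c x → pairs c c′ x y ≡ 1
  pairs-low {c} {c′} c≢c′ {x} y ¬h = ≤-antisym (+-cancelʳ-≤ v _ 1 (begin
    pairs c c′ x y + v   ≤⟨ pairs+v≤occ+1 c≢c′ x y ⟩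
    occ C c x + 1        ≡⟨ cong (_+ 1) (occ-low ¬h) ⟩
    v + 1                ≡⟨ +-comm v 1 ⟩
    1 + v                ∎))
    (pairs-covered c≢c′ x y)
    where open ≤-Reasoning

  pairs≤2 : ∀ {c c′} → c ≢ c′ → ∀ x y → pairs c c′ x y ≤ 2
  pairs≤2 {c} {c′} c≢c′ x y = +-cancelʳ-≤ v _ 2 (begin
    pairs c c′ x y + v   ≤⟨ pairs+v≤occ+1 c≢c′ x y ⟩
    occ C c x + 1        ≤⟨ +-monoˡ-≤ 1 (occ≤1+v c x) ⟩
    suc v + 1            ≡⟨ +-comm (suc v) 1 ⟩
    2 + v                ∎)
    where
    open ≤-Reasoning
    occ≤1+v : ∀ c x → occ C c x ≤ suc v
    occ≤1+v c x with occ≡v⊎1+v c x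
    ... | inj₁ occ≡v   = ≤-trans (≤-reflexive occ≡v) (n≤1+n v)
    ... | inj₂ occ≡1+v = ≤-reflexive occ≡1+v

  low-agreement : ∀ {c c′ r r′} → c ≢ c′ → Low r c → C r′ c ≡ C r c → C r′ c′ ≡ C r c′ → r ≡ r′
  low-agreement {c} {c′} {r} {r′} c≢c′ ¬h agree agree′ with r ≟ r′
  ... | yes r≡r′ = r≡r′
  ... | no r≢r′  = contradiction
    (subst (2 ≤_) (pairs-low c≢c′ (C r c′) ¬h)
      (count-pair (λ s → (C s c ≟ C r c) ×-dec (C s c′ ≟ C r c′)) r≢r′ (refl , refl) (agree , agree′)))
    (λ { (s≤s ()) })

  count-both-low : ∀ {c c′} → c ≢ c′ → count (bothLow? c c′) ≡ 1
  count-both-low {c} {c′} c≢c′ = trans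
    (count-cong (bothLow? c c′) (λ r → (C r c ≟ lowSymbol c) ×-dec (C r c′ ≟ lowSymbol c′))
      (λ r (l , l′) → low⇒≡lowSymbol l , low⇒≡lowSymbol l′)
      (λ r (e , e′) → ≡lowSymbol⇒low e , ≡lowSymbol⇒low e′))
    (pairs-low c≢c′ (lowSymbol c′) (lowSymbol-low c))

  count-both-high : ∀ {c c′} → c ≢ c′ → count (bothHigh? c c′) + (v + v) ≡ N + 1
  count-both-high {c} {c′} c≢c′ = begin
    count (bothHigh? c c′) + (v + v)
      ≡⟨ cong (count (bothHigh? c c′) +_)
              (sym (cong₂ _+_ (count-low-entries c) (count-low-entries c′))) ⟩
    count (bothHigh? c c′) + (count (λ r → low? r c) + count (λ r → low? r c′))
      ≡⟨ count-inclusion-exclusion (λ r → highFreq? C r c) (λ r → highFreq? C r c′) ⟩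
    N + count (bothLow? c c′)
      ≡⟨ cong (N +_) (count-both-low c≢c′) ⟩
    N + 1 ∎
    where open ≡-Reasoning

  hfCount≡count : ∀ r → hfCount C r ≡ count (highFreq? C r)
  hfCount≡count r = length-filter-tabulate (highFreq? C r) (λ c → c)

  hfCount≤k : ∀ r → hfCount C r ≤ k
  hfCount≤k r = subst (_≤ k) (sym (hfCount≡count r)) (count≤n (highFreq? C r))

  hfCount≡m⇒m≤count : ∀ {r m} → hfCount C r ≡ m → m ≤ count (highFreq? C r)
  hfCount≡m⇒m≤count {r} hf≡m = ≤-reflexive (trans (sym hf≡m) (hfCount≡count r))

  a≡count : ∀ i → a C i ≡ count (λ r → hfCount C r ℕ.≟ i)
  a≡count i = length-filter-tabulate (λ r → hfCount C r ℕ.≟ i) (λ r → r)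

  moment : (g : ℕ → ℕ) → sumTo k (λ i → g i * a C i) ≡ ∑[ r < N ] g (hfCount C r)
  moment g = begin
    sumTo k (λ i → g i * a C i)
      ≡⟨ sum-applyUpTo (λ i → g i * a C i) (λ i → i) (suc k) ⟩
    ∑[ i < suc k ] (g (toℕ i) * a C (toℕ i))
      ≡⟨ sum-cong-≗ {suc k} (λ i → cong (g (toℕ i) *_) (a≡count (toℕ i))) ⟩
    ∑[ i < suc k ] (g (toℕ i) * count (λ r → hfCount C r ℕ.≟ toℕ i))
      ≡⟨ ∑-fibres (hfCount C) (λ r → s≤s (hfCount≤k r)) g ⟩
    ∑[ r < N ] g (hfCount C r) ∎
    where open ≡-Reasoning

  count-high-entries≡ : ∀ c → count (λ r → highFreq? C r c) ≡ (v ∸ 1) * (v + 1)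
  count-high-entries≡ c = +-cancelʳ-≡ v _ _ (trans (count-high-entries c) (sym ([v∸1]*[v+1]+v≡N v)))

  count-both-high≡ : ∀ {c c′} → c ≢ c′ → count (bothHigh? c c′) ≡ (v ∸ 1) * v
  count-both-high≡ c≢c′ = +-cancelʳ-≡ (v + v) _ _ (trans (count-both-high c≢c′) (sym ([v∸1]*v+2v≡N+1 v)))

  ∑-hfCount : ∑[ r < N ] hfCount C r ≡ k * ((v ∸ 1) * (v + 1))
  ∑-hfCount = begin
    ∑[ r < N ] hfCount C r                         ≡⟨ sum-cong-≗ hfCount≡count ⟩
    ∑[ r < N ] ∑[ c < k ] 𝟙 (highFreq? C r c)      ≡⟨ ∑-comm {N} {k} (λ r c → 𝟙 (highFreq? C r c)) ⟩
    ∑[ c < k ] count (λ r → highFreq? C r c)       ≡⟨ sum-cong-≗ count-high-entries≡ ⟩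
    ∑[ c < k ] ((v ∸ 1) * (v + 1))                 ≡⟨ ∑-const k _ ⟩
    k * ((v ∸ 1) * (v + 1))                        ∎
    where open ≡-Reasoning

  ∑-count-both-high : ∀ c → ∑[ c′ < k ] count (bothHigh? c c′)
                            ≡ (v ∸ 1) * (v + 1) + (v + 1) * ((v ∸ 1) * v)
  ∑-count-both-high c = +-cancelʳ-≡ ((v ∸ 1) * v) _ _ (begin
    ∑[ c′ < k ] count (bothHigh? c c′) + (v ∸ 1) * v
      ≡⟨ ∑-except c (λ c′ c≢c′ → count-both-high≡ c≢c′) ⟩
    count (bothHigh? c c) + k * ((v ∸ 1) * v)
      ≡⟨ cong₂ _+_ diagonal (cong (_* ((v ∸ 1) * v)) (+-suc v 1)) ⟩
    (v ∸ 1) * (v + 1) + ((v ∸ 1) * v + (v + 1) * ((v ∸ 1) * v))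
      ≡⟨ lemma ((v ∸ 1) * (v + 1)) ((v ∸ 1) * v) ((v + 1) * ((v ∸ 1) * v)) ⟩
    (v ∸ 1) * (v + 1) + (v + 1) * ((v ∸ 1) * v) + (v ∸ 1) * v ∎)
    where
    open ≡-Reasoning
    diagonal : count (bothHigh? c c) ≡ (v ∸ 1) * (v + 1)
    diagonal = trans (count-cong _ (λ r → highFreq? C r c) (λ _ → proj₁) (λ _ h → h , h))
                     (count-high-entries≡ c)
    lemma : ∀ x y z → x + (y + z) ≡ x + z + y
    lemma = solve-∀

  ∑-hfCount² : ∑[ r < N ] (hfCount C r * hfCount C r) ≡ k * ((v ∸ 1) * (v + 1) + (v + 1) * ((v ∸ 1) * v))
  ∑-hfCount² = begin
    ∑[ r < N ] (hfCount C r * hfCount C r)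
      ≡⟨ sum-cong-≗ (λ r → trans (cong (λ h → h * h) (hfCount≡count r)) (square r)) ⟩
    ∑[ r < N ] ∑[ c < k ] ∑[ c′ < k ] 𝟙 (bothHigh? c c′ r)
      ≡⟨ ∑-comm {N} {k} (λ r c → ∑[ c′ < k ] 𝟙 (bothHigh? c c′ r)) ⟩
    ∑[ c < k ] ∑[ r < N ] ∑[ c′ < k ] 𝟙 (bothHigh? c c′ r)
      ≡⟨ sum-cong-≗ (λ c → ∑-comm {N} {k} (λ r c′ → 𝟙 (bothHigh? c c′ r))) ⟩
    ∑[ c < k ] ∑[ c′ < k ] count (bothHigh? c c′)
      ≡⟨ sum-cong-≗ ∑-count-both-high ⟩
    ∑[ c < k ] ((v ∸ 1) * (v + 1) + (v + 1) * ((v ∸ 1) * v))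
      ≡⟨ ∑-const k _ ⟩
    k * ((v ∸ 1) * (v + 1) + (v + 1) * ((v ∸ 1) * v)) ∎
    where
    open ≡-Reasoning
    square : ∀ r → count (highFreq? C r) * count (highFreq? C r)
                   ≡ ∑[ c < k ] ∑[ c′ < k ] 𝟙 (bothHigh? c c′ r)
    square r = begin
      count (highFreq? C r) * count (highFreq? C r)
        ≡⟨ *-distribʳ-sum (count (highFreq? C r)) (𝟙 ∘ highFreq? C r) ⟩
      ∑[ c < k ] (𝟙 (highFreq? C r c) * count (highFreq? C r))
        ≡⟨ sum-cong-≗ (λ c → *-distribˡ-sum (𝟙 (highFreq? C r c)) (𝟙 ∘ highFreq? C r)) ⟩
      ∑[ c < k ] ∑[ c′ < k ] (𝟙 (highFreq? C r c) * 𝟙 (highFreq? C r c′))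
        ≡⟨ sum-cong-≗ (λ c → sum-cong-≗ (λ c′ → 𝟙-× (highFreq? C r c) (highFreq? C r c′))) ⟨
      ∑[ c < k ] ∑[ c′ < k ] 𝟙 (bothHigh? c c′ r) ∎

  hfCount≡0⇒low : ∀ {r} → hfCount C r ≡ 0 → ∀ c → Low r c
  hfCount≡0⇒low {r} hf≡0 c h =
    contradiction (subst (1 ≤_) (trans (sym (hfCount≡count r)) hf≡0) (count-pos (highFreq? C r) h)) (λ ())

  a₀≤1 : ∀ {c c′} → c ≢ c′ → a C 0 ≤ 1
  a₀≤1 {c} {c′} c≢c′ = begin
    a C 0                                        ≡⟨ a≡count 0 ⟩
    count (λ r → hfCount C r ℕ.≟ 0)
      ≤⟨ count-mono _ (bothLow? c c′) (λ r hf≡0 → hfCount≡0⇒low hf≡0 c , hfCount≡0⇒low hf≡0 c′) ⟩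
    count (bothLow? c c′)
      ≡⟨ count-both-low c≢c′ ⟩
    1 ∎
    where open ≤-Reasoning

  module LowAgreement (r : Fin N) where

    lowAgrees? : ∀ r′ c → Dec (Low r c × C r′ c ≡ C r c)
    lowAgrees? r′ c = low? r c ×-dec (C r′ c ≟ C r c)

    lowAgreements : Fin N → ℕ
    lowAgreements r′ = count (lowAgrees? r′)

    lowColumns : ℕ
    lowColumns = count (low? r)

    ∑-lowAgreements : ∑[ r′ < N ] lowAgreements r′ ≡ lowColumns * v
    ∑-lowAgreements = begin
      ∑[ r′ < N ] lowAgreements r′               ≡⟨ ∑-comm {N} {k} (λ r′ c → 𝟙 (lowAgrees? r′ c)) ⟩
      ∑[ c < k ] count (λ r′ → lowAgrees? r′ c)  ≡⟨ sum-cong-≗ column ⟩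
      ∑[ c < k ] (𝟙 (low? r c) * v)              ≡⟨ *-distribʳ-sum v (𝟙 ∘ low? r) ⟨
      lowColumns * v                             ∎
      where
      open ≡-Reasoning
      column : ∀ c → count (λ r′ → lowAgrees? r′ c) ≡ 𝟙 (low? r c) * v
      column c = begin
        count (λ r′ → lowAgrees? r′ c)
          ≡⟨ sum-cong-≗ (λ r′ → 𝟙-× (low? r c) (C r′ c ≟ C r c)) ⟩
        ∑[ r′ < N ] (𝟙 (low? r c) * 𝟙 (C r′ c ≟ C r c))
          ≡⟨ *-distribˡ-sum (𝟙 (low? r c)) (λ r′ → 𝟙 (C r′ c ≟ C r c)) ⟨
        𝟙 (low? r c) * count (λ r′ → C r′ c ≟ C r c)
          ≡⟨ cong (𝟙 (low? r c) *_) (occ≡count c (C r c)) ⟨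
        𝟙 (low? r c) * occ C c (C r c)
          ≡⟨ low-occ (low? r c) ⟩
        𝟙 (low? r c) * v ∎
        where
        low-occ : (l? : Dec (Low r c)) → 𝟙 l? * occ C c (C r c) ≡ 𝟙 l? * v
        low-occ (yes l) = cong (_+ 0) (occ-low l)
        low-occ (no _)  = refl

    lowAgreements-self : lowAgreements r ≡ lowColumns
    lowAgreements-self = count-cong (lowAgrees? r) (low? r) (λ _ → proj₁) (λ _ l → l , refl)

    lowAgreements≤1 : ∀ r′ → r ≢ r′ → lowAgreements r′ ≤ 1
    lowAgreements≤1 r′ r≢r′ = count≤1 (lowAgrees? r′) unique
      where
      unique : ∀ c c′ → Low r c × C r′ c ≡ C r c → Low r c′ × C r′ c′ ≡ C r c′ → c ≡ c′
      unique c c′ (l , agree) (_ , agree′) with c ≟ c′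
      ... | yes c≡c′ = c≡c′
      ... | no c≢c′  = contradiction (low-agreement c≢c′ l agree agree′) r≢r′

    agreeing disjoint : ℕ
    agreeing = count (λ r′ → 1 ≤? lowAgreements r′)
    disjoint = count (λ r′ → lowAgreements r′ ℕ.≟ 0)

    agreeing+disjoint : agreeing + disjoint ≡ N
    agreeing+disjoint = trans
      (cong (agreeing +_) (count-cong (λ r′ → lowAgreements r′ ℕ.≟ 0) (λ r′ → ¬? (1 ≤? lowAgreements r′))
        (λ r′ a≡0 1≤a → contradiction (subst (1 ≤_) a≡0 1≤a) (λ ()))
        (λ r′ 1≰a → n<1⇒n≡0 (≰⇒> 1≰a))))
      (count-complement (λ r′ → 1 ≤? lowAgreements r′))

    agreeing+disjoint+1≡v*v+v : agreeing + disjoint + 1 ≡ v * v + v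
    agreeing+disjoint+1≡v*v+v = trans (cong (_+ 1) agreeing+disjoint) N+1≡v*v+v

    lowColumns*v+1≤agreeing+lowColumns : 1 ≤ lowColumns → lowColumns * v + 1 ≤ agreeing + lowColumns
    lowColumns*v+1≤agreeing+lowColumns 1≤lowColumns =
      subst₂ (λ s t → s + 1 ≤ agreeing + t) ∑-lowAgreements lowAgreements-self
        (∑≤support r (subst (1 ≤_) (sym lowAgreements-self) 1≤lowColumns) lowAgreements≤1)

    self-or-disjoint? : ∀ r′ → Dec (r ≡ r′ ⊎ lowAgreements r′ ≡ 0)
    self-or-disjoint? r′ = (r ≟ r′) ⊎-dec (lowAgreements r′ ℕ.≟ 0)

    count-self-or-disjoint : count self-or-disjoint? ≤ 1 + disjoint
    count-self-or-disjoint = ≤-trans (count-⊎≤ (r ≟_) (λ r′ → lowAgreements r′ ℕ.≟ 0))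
                            (≤-reflexive (cong (_+ disjoint) (count-≡ r)))

    high-agreement : ∀ {d r′} → HighFreq C r d → C r′ d ≡ C r d → r ≡ r′ ⊎ lowAgreements r′ ≡ 0
    high-agreement {d} {r′} h agree with r ≟ r′ | lowAgreements r′ ℕ.≟ 0
    ... | yes r≡r′ | _        = inj₁ r≡r′
    ... | no _     | yes a≡0  = inj₂ a≡0
    ... | no r≢r′  | no a≢0   =
      let (c , l , agree′) = count-witness (lowAgrees? r′) (n≢0⇒n>0 a≢0)
          c≢d : c ≢ d
          c≢d c≡d = l (subst (HighFreq C r) (sym c≡d) h)
      in contradiction (low-agreement c≢d l agree′ agree) r≢r′

    agreeing-on-high : ∀ {d} → HighFreq C r d → count (λ r′ → C r′ d ≟ C r d) ≤ count self-or-disjoint?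
    agreeing-on-high h = count-mono _ self-or-disjoint? (λ r′ → high-agreement h)

  hfCount+lowColumns : ∀ r → hfCount C r + LowAgreement.lowColumns r ≡ k
  hfCount+lowColumns r = trans (cong (_+ count (low? r)) (hfCount≡count r)) (count-complement (highFreq? C r))

  no-row-with-one-high-entry : ∀ r → hfCount C r ≢ 1
  no-row-with-one-high-entry r hf≡1
    with d , h ← count-witness (highFreq? C r) (hfCount≡m⇒m≤count hf≡1) =
    1+n≰n (begin
      suc (v * v + v + (v + 1))            ≡⟨ lhs v ⟨
      (v + 1) * v + 1 + suc v              ≤⟨ +-mono-≤ agreeing-bound disjoint-bound ⟩
      agreeing + (v + 1) + (1 + disjoint)  ≡⟨ rhs v agreeing disjoint ⟩
      agreeing + disjoint + 1 + (v + 1)    ≡⟨ cong (_+ (v + 1)) agreeing+disjoint+1≡v*v+v ⟩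
      v * v + v + (v + 1)                  ∎)
    where
    open LowAgreement r
    open ≤-Reasoning
    lowColumns≡v+1 : lowColumns ≡ v + 1
    lowColumns≡v+1 = suc-injective (trans (cong (_+ lowColumns) (sym hf≡1))
                                          (trans (hfCount+lowColumns r) (+-suc v 1)))
    agreeing-bound : (v + 1) * v + 1 ≤ agreeing + (v + 1)
    agreeing-bound = subst (λ s → s * v + 1 ≤ agreeing + s) lowColumns≡v+1
      (lowColumns*v+1≤agreeing+lowColumns (subst (1 ≤_) (sym lowColumns≡v+1) (m≤n+m 1 v)))
    disjoint-bound : suc v ≤ 1 + disjoint
    disjoint-bound = begin
      suc v                               ≡⟨ occ-high h ⟨
      occ C d (C r d)                     ≡⟨ occ≡count d (C r d) ⟩
      count (λ r′ → C r′ d ≟ C r d)       ≤⟨ agreeing-on-high h ⟩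
      count self-or-disjoint?                      ≤⟨ count-self-or-disjoint ⟩
      1 + disjoint                        ∎
    lhs : ∀ v → (v + 1) * v + 1 + suc v ≡ suc (v * v + v + (v + 1))
    lhs = solve-∀
    rhs : ∀ v Z Z₀ → Z + (v + 1) + (1 + Z₀) ≡ Z + Z₀ + 1 + (v + 1)
    rhs = solve-∀

  no-row-with-two-high-entries : ∀ r → hfCount C r ≢ 2
  no-row-with-two-high-entries r hf≡2
    with d , d′ , d≢d′ , h , h′ ← count-two-witnesses (highFreq? C r) (hfCount≡m⇒m≤count hf≡2) =
    1+n≰n (begin
      suc (v * v + v + (v + 2))            ≡⟨ lhs v ⟨
      v * v + 1 + (suc v + suc v)          ≤⟨ +-mono-≤ agreeing-bound disjoint-bound ⟩
      agreeing + v + (2 + (1 + disjoint))  ≡⟨ rhs v agreeing disjoint ⟩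
      agreeing + disjoint + 1 + (v + 2)    ≡⟨ cong (_+ (v + 2)) agreeing+disjoint+1≡v*v+v ⟩
      v * v + v + (v + 2)                  ∎)
    where
    open LowAgreement r
    open ≤-Reasoning
    agrees : ∀ d r′ → Dec (C r′ d ≡ C r d)
    agrees d r′ = C r′ d ≟ C r d
    lowColumns≡v : lowColumns ≡ v
    lowColumns≡v = +-cancelˡ-≡ 2 _ _ (trans (cong (_+ lowColumns) (sym hf≡2))
                                            (trans (hfCount+lowColumns r) (+-comm v 2)))
    agreeing-bound : v * v + 1 ≤ agreeing + v
    agreeing-bound = subst (λ s → s * v + 1 ≤ agreeing + s) lowColumns≡v
      (lowColumns*v+1≤agreeing+lowColumns (subst (1 ≤_) (sym lowColumns≡v) (>-nonZero⁻¹ v)))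
    disjoint-bound : suc v + suc v ≤ 2 + (1 + disjoint)
    disjoint-bound = begin
      suc v + suc v                                    ≡⟨ cong₂ _+_ (occ-high h) (occ-high h′) ⟨
      occ C d (C r d) + occ C d′ (C r d′)
        ≡⟨ cong₂ _+_ (occ≡count d (C r d)) (occ≡count d′ (C r d′)) ⟩
      count (agrees d) + count (agrees d′)             ≡⟨ count-∪ (agrees d) (agrees d′) ⟩
      pairs d d′ (C r d) (C r d′) + count (λ r′ → agrees d r′ ⊎-dec agrees d′ r′)
        ≤⟨ +-mono-≤ (pairs≤2 d≢d′ (C r d) (C r d′))
                    (count-mono _ self-or-disjoint? (λ r′ → [ high-agreement h , high-agreement h′ ])) ⟩
      2 + count self-or-disjoint?                               ≤⟨ +-monoʳ-≤ 2 count-self-or-disjoint ⟩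
      2 + (1 + disjoint)                               ∎
    lhs : ∀ v → v * v + 1 + (suc v + suc v) ≡ suc (v * v + v + (v + 2))
    lhs = solve-∀
    rhs : ∀ v Z Z₀ → Z + v + (2 + (1 + Z₀)) ≡ Z + Z₀ + 1 + (v + 2)
    rhs = solve-∀

  ∑-a : sumTo k (a C) ≡ N
  ∑-a = begin
    sumTo k (a C)
      ≡⟨ cong List.sum (map-cong (λ i → sym (*-identityˡ (a C i))) (upTo (suc k))) ⟩
    sumTo k (λ i → 1 * a C i)         ≡⟨ moment (λ _ → 1) ⟩
    ∑[ r < N ] 1                      ≡⟨ ∑-one N ⟩
    N                                 ∎
    where open ≡-Reasoning

  a₁≡0 : a C 1 ≡ 0
  a₁≡0 = trans (a≡count 1) (count-none _ no-row-with-one-high-entry)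

  a₂≡0 : a C 2 ≡ 0
  a₂≡0 = trans (a≡count 2) (count-none _ no-row-with-two-high-entries)

theorem2 : (v : ℕ) → 2 ≤ v → .{{_ : NonZero v}} →
    (C : Array (v * v + v ∸ 1) (v + 2) v) → IsUCA C →
      (sumTo (v + 2) (λ i → a C i) ≡ v * v + v ∸ 1)
      × (sumTo (v + 2) (λ i → i * a C i) ≡ (v + 2) * (v ∸ 1) * (v + 1))
      × (sumTo (v + 2) (λ i → i * i * a C i) ≡ (v + 2) * ((v + 1) * (v + 1)) * (v ∸ 1))
      × (a C 0 ≤ 1)
      × (a C 1 ≡ 0)
      × (a C 2 ≡ 0)
theorem2 v@(suc (suc w)) 2≤v@(s≤s (s≤s z≤n)) C (covering , uniform) =
  ∑-a ,
  trans (moment (λ i → i)) (trans ∑-hfCount (sym (*-assoc (v + 2) (suc w) (v + 1)))) ,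
  trans (moment (λ i → i * i)) (trans ∑-hfCount² (second-moment w)) ,
  a₀≤1 {zero} {suc zero} (λ ()) ,
  a₁≡0 ,
  a₂≡0
  where
  open UniformCoveringArray C covering (uniform⇒occ≡v⊎1+v C 2≤v uniform)
  second-moment : ∀ w → let v = suc (suc w) in
    (v + 2) * (suc w * (v + 1) + (v + 1) * (suc w * v)) ≡ (v + 2) * ((v + 1) * (v + 1)) * suc w
  second-moment = solve-∀
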